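{- Let $n$ and $m$ be positive integers with $m\geq n+1$. For every integer $r$ with $1\leq r\leq m-2$ there is a bijection from $\mathcal{M}_{n,m,r}$ onto $\mathcal{M}_{n,m,r+1}$.
   Context: An $(n,m)$-lattice path is a sequence $P=(x_1,y_1)(x_2,y_2)\cdots(x_{n+1},y_{n+1})$ of vectors in $\mathbb{Z}^2$ such that $1-n\leq y_i\leq 1$ for all $i$, $\sum_{i=1}^{n+1}y_i=1$, $1\leq x_i\leq m-1$ for all $i$, and $\sum_{i=1}^{n+1}x_i=m$. For such $P$ put $a_0=b_0=0$, $a_i=\sum_{j=1}^{i}y_j$ and $b_i=\sum_{j=1}^{i}x_j$ for $1\leq i\leq n+1$, and view $P$ as the sequence of points $(b_0,a_0),(b_1,a_1),\ldots,(b_{n+1},a_{n+1})$. A minimum point of $P$ is a point $(b_i,a_i)$ with $a_i\leq a_j$ for all $j\in\{0,\ldots,n+1\}$; the rightmost minimum point is the minimum point $(b_i,a_i)$ with the largest $b_i$ (equivalently the largest index $i$). If $(b_i,a_i)$ is the rightmost minimum point, the rightmost minimum length of $P$ is $RML(P)=b_i$. For an integer $r$, $\mathcal{M}_{n,m,r}$ denotes the set of all $(n,m)$-lattice paths $P$ with $RML(P)=r$. -}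

module Defs where

open import Data.Nat as ℕ using (ℕ; suc; _∸_)
open import Data.Integer as ℤ using (ℤ; +_; -_)
open import Data.Fin using (Fin; toℕ)
open import Data.Vec using (Vec; toList; lookup)
open import Data.List using (List; take; map)
open import Data.Nat.ListAction using (sum)
import Data.Integer.Base as ℤB
open import Data.Product using (Σ; _×_; proj₁; proj₂)
open import Relation.Binary.PropositionalEquality using (_≡_)
import Relation.Binary.PropositionalEquality as ≡
open import Relation.Binary.Bundles using (Setoid)
import Relation.Binary.Construct.On as On

Steps : ℕ → Set
Steps n = Vec (ℕ × ℤ) (suc n)

xs : ∀ {n} → Steps n → List ℕ
xs v = map proj₁ (toList v)

ys : ∀ {n} → Steps n → List ℤ
ys v = map proj₂ (toList v)

sumℤ : List ℤ → ℤ
sumℤ = Data.List.foldr ℤ._+_ (+ 0)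

aPt : ∀ {n} → Steps n → Fin (suc (suc n)) → ℤ
aPt v i = sumℤ (take (toℕ i) (ys v))

bPt : ∀ {n} → Steps n → Fin (suc (suc n)) → ℕ
bPt v i = sum (take (toℕ i) (xs v))

IsLatticePath : (n m : ℕ) → Steps n → Set
IsLatticePath n m v =
  (∀ (i : Fin (suc n)) →
      (+ 1 ℤ.- + n ℤ.≤ proj₂ (lookup v i)) × (proj₂ (lookup v i) ℤ.≤ + 1)
    × (1 ℕ.≤ proj₁ (lookup v i)) × (proj₁ (lookup v i) ℕ.≤ m ∸ 1))
  × (sumℤ (ys v) ≡ + 1)
  × (sum (xs v) ≡ m)

IsMinPoint : ∀ {n} → Steps n → Fin (suc (suc n)) → Set
IsMinPoint {n} v i = ∀ (j : Fin (suc (suc n))) → aPt v i ℤ.≤ aPt v j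

HasRML : ∀ {n} → Steps n → ℕ → Set
HasRML {n} v r =
  Σ (Fin (suc (suc n))) λ i →
    IsMinPoint v i
    × (∀ (j : Fin (suc (suc n))) → IsMinPoint v j → toℕ j ℕ.≤ toℕ i)
    × (bPt v i ≡ r)

M : (n m r : ℕ) → Set
M n m r = Σ (Steps n) λ v → IsLatticePath n m v × HasRML v r

MSetoid : (n m r : ℕ) → Setoid _ _
MSetoid n m r = On.setoid {B = M n m r} (≡.setoid (Steps n)) proj₁

-- Let e be the last step of a path in 𝓜_{n,m,r}.  If e has x-length 1, move it to
-- the front: the old points are translated by (1, y_e) and the origin is prepended,
-- so the rightmost minimum moves one unit to the right as long as it lies strictly
-- below the old penultimate point (height 1 − y_e), i.e. is not that point; this is
-- what r ≤ m − 2 guarantees, that point having b-coordinate m − 1.  If e has x-length at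
-- least 2, move one unit of x-length from e to the first step: heights are
-- unchanged and every interior point, in particular the minimum (r ≥ 1 rules out
-- the first point and height 1 the last), moves one unit to the right.  The first
-- step of the image has x-length 1 in the first case and at least 2 in the second,
-- which tells the cases apart and yields the inverse.
module Submission where

open import Defs
open import Data.Nat using (ℕ; suc; _≤_; _∸_; _+_)
open import Function.Bundles using (Bijection)

open import Algebra.Bundles using (CommutativeMonoid)
open import Data.Fin as Fin using (Fin; toℕ; fromℕ<)
import Data.Fin.Properties as FP
open import Data.Integer as ℤ using (ℤ; +_; +<+)
  renaming (_≤_ to _≤ℤ_; _<_ to _<ℤ_; _+_ to _+ℤ_)
import Data.Integer.Properties as ℤP
open import Data.List using (List; _∷_; _++_; [_]; take; length; map)
import Data.List.Properties as LP
open import Data.List.Relation.Binary.Permutation.Propositional using (_↭_; ↭-sym; ↭⇒↭ₛ)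
import Data.List.Relation.Binary.Permutation.Propositional.Properties as ↭P
open import Data.List.Relation.Binary.Permutation.Setoid.Properties using (foldr-commMonoid)
open import Data.List.Relation.Unary.All as All using (All)
import Data.List.Relation.Unary.All.Properties as AllP
open import Data.Nat as ℕ using (zero; _<_; _≮_; z≤n; s≤s; _<?_; _≤?_)
open import Data.Nat.ListAction using (sum)
open import Data.Nat.ListAction.Properties using (sum-++; sum-↭)
import Data.Nat.Properties as ℕP
open import Data.Nat.Tactic.RingSolver using (solve-∀)
open import Data.Product using (_×_; _,_; proj₁; proj₂; Σ)
open import Data.Vec as V using (Vec; _∷ʳ_; init; last; initLast; toList)
import Data.Vec.Properties as VP
import Data.Vec.Relation.Unary.All.Properties as VAllP
open import Function using (_∘_)
open import Function.Bundles using (_⇔_; mk⇔; Equivalence)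
import Function.Properties.Equivalence as ⇔
open import Function.Properties.Inverse using (Inverse⇒Bijection)
open import Relation.Binary.Core using (_Preserves_⟶_)
open import Relation.Binary.PropositionalEquality hiding ([_])
open import Relation.Nullary using (yes; no; contradiction)

open Equivalence using (to; from)

-- Prefix sums

take-++ˡ : ∀ {A : Set} (p q : List A) {k} → k ≤ length p → take k (p ++ q) ≡ take k p
take-++ˡ p       q {zero}  _         = refl
take-++ˡ (x ∷ p) q {suc k} (s≤s k≤p) = cong (x ∷_) (take-++ˡ p q k≤p)

length-∷ʳ : ∀ {A : Set} (p : List A) x → length (p ++ [ x ]) ≡ suc (length p)
length-∷ʳ p x = trans (LP.length-++ p) (ℕP.+-comm (length p) 1)

prefixℤ : List ℤ → ℕ → ℤ
prefixℤ l k = sumℤ (take k l)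

prefixℕ : List ℕ → ℕ → ℕ
prefixℕ l k = sum (take k l)

prefixℤ-++ˡ : ∀ p q {k} → k ≤ length p → prefixℤ (p ++ q) k ≡ prefixℤ p k
prefixℤ-++ˡ p q k≤p = cong sumℤ (take-++ˡ p q k≤p)

prefixℕ-++ˡ : ∀ p q {k} → k ≤ length p → prefixℕ (p ++ q) k ≡ prefixℕ p k
prefixℕ-++ˡ p q k≤p = cong sum (take-++ˡ p q k≤p)

prefixℤ-all : ∀ l {k} → length l ≤ k → prefixℤ l k ≡ sumℤ l
prefixℤ-all l {k} l≤k = cong sumℤ (LP.take-all k l l≤k)

prefixℕ-all : ∀ l {k} → length l ≤ k → prefixℕ l k ≡ sum l
prefixℕ-all l {k} l≤k = cong sum (LP.take-all k l l≤k)

sumℤ-↭ : sumℤ Preserves _↭_ ⟶ _≡_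
sumℤ-↭ p = foldr-commMonoid ℤ-+-0.setoid ℤ-+-0.isCommutativeMonoid (↭⇒↭ₛ p)
  where module ℤ-+-0 = CommutativeMonoid ℤP.+-0-commutativeMonoid

prefixℤ-beyond : ∀ l → sumℤ l ≡ + 1 → ∀ j → length l ≤ j → prefixℤ l 0 <ℤ prefixℤ l j
prefixℤ-beyond l total j l≤j =
  subst (+ 0 <ℤ_) (sym (trans (prefixℤ-all l l≤j) total)) (+<+ (s≤s z≤n))

+-cancelˡ-≤ : ∀ c {i j} → c +ℤ i ≤ℤ c +ℤ j → i ≤ℤ j
+-cancelˡ-≤ c {i} {j} c+i≤c+j with i ℤ.≤? j
... | yes i≤j = i≤j
... | no  i≰j = contradiction c+i≤c+j (ℤP.<⇒≱ (ℤP.+-monoʳ-< c (ℤP.≰⇒> i≰j)))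

+-cancelˡ-< : ∀ c {i j} → c +ℤ i <ℤ c +ℤ j → i <ℤ j
+-cancelˡ-< c {i} {j} c+i<c+j with j ℤ.≤? i
... | yes j≤i = contradiction (ℤP.+-monoʳ-≤ c j≤i) (ℤP.<⇒≱ c+i<c+j)
... | no  j≰i = ℤP.≰⇒> j≰i

-- Rightmost minima

-- Indices range over all of ℕ, where prefix sums are constant past the end of a
-- list, instead of over Fin as in HasRML.
IsRightmostMin : (ℕ → ℤ) → ℕ → Set
IsRightmostMin f k = (∀ j → f k ≤ℤ f j) × (∀ j → k < j → f k <ℤ f j)

isRightmostMin-< : ∀ {f k} N → (∀ j → N ≤ j → f 0 <ℤ f j) → IsRightmostMin f k → k < N
isRightmostMin-< {k = k} N above (min , _) with k <? N
... | yes k<N = k<N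
... | no  k≮N = contradiction (min 0) (ℤP.<⇒≱ (above k (ℕP.≮⇒≥ k≮N)))

isRightmostMin-suc : ∀ {f k} →
  IsRightmostMin f (suc k) ⇔ (f (suc k) ≤ℤ f 0 × IsRightmostMin (f ∘ suc) k)
isRightmostMin-suc {f} {k} = mk⇔
  (λ (min , strict) → min 0 , min ∘ suc , λ j k<j → strict (suc j) (s≤s k<j))
  (λ (below₀ , min , strict) → extendMin below₀ min , extendStrict strict)
  where
  extendMin : f (suc k) ≤ℤ f 0 → (∀ j → f (suc k) ≤ℤ f (suc j)) → ∀ j → f (suc k) ≤ℤ f j
  extendMin below₀ _   zero    = below₀
  extendMin _      min (suc j) = min j
  extendStrict : (∀ j → k < j → f (suc k) <ℤ f (suc j)) → ∀ j → suc k < j → f (suc k) <ℤ f j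
  extendStrict strict (suc j) (s≤s k<j) = strict j k<j

isRightmostMin-+ : ∀ {f k} c → IsRightmostMin (λ j → c +ℤ f j) k ⇔ IsRightmostMin f k
isRightmostMin-+ c = mk⇔
  (λ (min , strict) → +-cancelˡ-≤ c ∘ min , λ j → +-cancelˡ-< c ∘ strict j)
  (λ (min , strict) → ℤP.+-monoʳ-≤ c ∘ min , λ j → ℤP.+-monoʳ-< c ∘ strict j)

isRightmostMin-extend : ∀ {f g k} L → k ≤ L → (∀ j → j ≤ L → f j ≡ g j) →
  (∀ j → L < j → f k <ℤ g j) → IsRightmostMin f k → IsRightmostMin g k
isRightmostMin-extend {f} {g} {k} L k≤L f≗g f<g (min , strict) = min′ , strict′
  where
  fk≡gk : f k ≡ g k
  fk≡gk = f≗g k k≤L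
  min′ : ∀ j → g k ≤ℤ g j
  min′ j with j ≤? L
  ... | yes j≤L = subst₂ _≤ℤ_ fk≡gk (f≗g j j≤L) (min j)
  ... | no  j≰L = subst (_≤ℤ g j) fk≡gk (ℤP.<⇒≤ (f<g j (ℕP.≰⇒> j≰L)))
  strict′ : ∀ j → k < j → g k <ℤ g j
  strict′ j k<j with j ≤? L
  ... | yes j≤L = subst₂ _<ℤ_ fk≡gk (f≗g j j≤L) (strict j k<j)
  ... | no  j≰L = subst (_<ℤ g j) fk≡gk (f<g j (ℕP.≰⇒> j≰L))

isRightmostMin-fromFin : ∀ {N f} (i : Fin (suc N)) → (∀ j → suc N ≤ j → f 0 <ℤ f j) →
  (∀ j → f (toℕ i) ≤ℤ f (toℕ j)) → (∀ j → (∀ l → f (toℕ j) ≤ℤ f (toℕ l)) → toℕ j ≤ toℕ i) →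
  IsRightmostMin f (toℕ i)
isRightmostMin-fromFin {N} {f} i above min rightmost = min′ , strict′
  where
  beyond : ∀ j → j ≮ suc N → f (toℕ i) <ℤ f j
  beyond j j≮N = ℤP.≤-<-trans (min Fin.zero) (above j (ℕP.≮⇒≥ j≮N))
  min′ : ∀ j → f (toℕ i) ≤ℤ f j
  min′ j with j <? suc N
  ... | yes j<N = subst (λ t → f (toℕ i) ≤ℤ f t) (FP.toℕ-fromℕ< j<N) (min (fromℕ< j<N))
  ... | no  j≮N = ℤP.<⇒≤ (beyond j j≮N)
  strict′ : ∀ j → toℕ i < j → f (toℕ i) <ℤ f j
  strict′ j i<j with j <? suc N
  ... | no  j≮N = beyond j j≮N
  ... | yes j<N = ℤP.≰⇒> λ fj≤fi → ℕP.<⇒≱ i<j (subst (_≤ toℕ i) (FP.toℕ-fromℕ< j<N)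
        (rightmost (fromℕ< j<N) λ l → subst (λ t → f t ≤ℤ f (toℕ l)) (sym (FP.toℕ-fromℕ< j<N))
          (ℤP.≤-trans fj≤fi (min l))))

isRightmostMin⇒rightmost : ∀ {N f} (i : Fin N) → IsRightmostMin f (toℕ i) →
  ∀ (j : Fin N) → (∀ l → f (toℕ j) ≤ℤ f (toℕ l)) → toℕ j ≤ toℕ i
isRightmostMin⇒rightmost i (_ , strict) j minⱼ with toℕ j ≤? toℕ i
... | yes j≤i = j≤i
... | no  j≰i = contradiction (minⱼ i) (ℤP.<⇒≱ (strict (toℕ j) (ℕP.≰⇒> j≰i)))

isRightmostMin-∷ : ∀ y p {k} → k < length p → sumℤ (y ∷ p) ≡ + 1 →
  IsRightmostMin (prefixℤ (y ∷ p)) (suc k) ⇔ IsRightmostMin (prefixℤ p) k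
isRightmostMin-∷ y p {k} k<L total = mk⇔
  (λ rm → to (isRightmostMin-+ y) (proj₂ (to isRightmostMin-suc rm)))
  (λ rm → from isRightmostMin-suc (nonPositive rm , from (isRightmostMin-+ y) rm))
  where
  nonPositive : IsRightmostMin (prefixℤ p) k → y +ℤ prefixℤ p k ≤ℤ + 0
  nonPositive (_ , strict) = ℤP.i<j⇒i≤pred[j]
    (subst (y +ℤ prefixℤ p k <ℤ_) (trans (cong (y +ℤ_) (prefixℤ-all p ℕP.≤-refl)) total)
      (ℤP.+-monoʳ-< y (strict (length p) k<L)))

isRightmostMin-∷ʳ : ∀ p y {k} → k < length p → sumℤ (p ++ [ y ]) ≡ + 1 →
  IsRightmostMin (prefixℤ (p ++ [ y ])) k ⇔ IsRightmostMin (prefixℤ p) k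
isRightmostMin-∷ʳ p y {k} k<L total = mk⇔
  (λ rm → isRightmostMin-extend L k≤L (λ j → prefixℤ-++ˡ p [ y ]) (belowSum rm) rm)
  (λ rm → isRightmostMin-extend L k≤L (λ j → sym ∘ prefixℤ-++ˡ p [ y ]) (belowTotal rm) rm)
  where
  L : ℕ
  L = length p
  k≤L : k ≤ L
  k≤L = ℕP.<⇒≤ k<L
  belowSum : IsRightmostMin (prefixℤ (p ++ [ y ])) k → ∀ j → L < j →
             prefixℤ (p ++ [ y ]) k <ℤ prefixℤ p j
  belowSum (_ , strict) j L<j = subst (_ <ℤ_) lastPrefix (strict L k<L)
    where
    lastPrefix : prefixℤ (p ++ [ y ]) L ≡ prefixℤ p j
    lastPrefix = begin
      prefixℤ (p ++ [ y ]) L ≡⟨ prefixℤ-++ˡ p [ y ] ℕP.≤-refl ⟩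
      prefixℤ p L            ≡⟨ prefixℤ-all p ℕP.≤-refl ⟩
      sumℤ p                 ≡⟨ prefixℤ-all p (ℕP.<⇒≤ L<j) ⟨
      prefixℤ p j            ∎
      where open ≡-Reasoning
  belowTotal : IsRightmostMin (prefixℤ p) k → ∀ j → L < j →
               prefixℤ p k <ℤ prefixℤ (p ++ [ y ]) j
  belowTotal (min , _) j L<j = ℤP.≤-<-trans (min 0)
    (prefixℤ-beyond (p ++ [ y ]) total j (ℕP.≤-trans (ℕP.≤-reflexive (length-∷ʳ p y)) L<j))

isRightmostMin-rotate : ∀ p y {k} → k < length p → sumℤ (y ∷ p) ≡ + 1 →
  IsRightmostMin (prefixℤ (p ++ [ y ])) k ⇔ IsRightmostMin (prefixℤ (y ∷ p)) (suc k)
isRightmostMin-rotate p y k<L total = ⇔.trans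
  (isRightmostMin-∷ʳ p y k<L (trans (sumℤ-↭ (↭-sym (↭P.∷↭∷ʳ y p))) total))
  (⇔.sym (isRightmostMin-∷ y p k<L total))

-- dys and dxs are the y- and x-coordinates of the steps, so that prefixℤ dys k and
-- prefixℕ dxs k are the coordinates a_k and b_k of the k-th point.
HasRMLᴸ : List ℤ → List ℕ → ℕ → Set
HasRMLᴸ dys dxs r = Σ ℕ λ k → IsRightmostMin (prefixℤ dys) k × prefixℕ dxs k ≡ r

hasRMLᴸ-rotate : ∀ p q y x {r} → length p ≡ length q → sumℤ (y ∷ p) ≡ + 1 → 1 ≤ x → r < sum q →
  HasRMLᴸ (p ++ [ y ]) (q ++ [ x ]) r ⇔ HasRMLᴸ (y ∷ p) (x ∷ q) (x + r)
hasRMLᴸ-rotate p q y x {r} p≡q total 1≤x r<sum = mk⇔ rotateʳ rotateˡ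
  where
  total′ : sumℤ (p ++ [ y ]) ≡ + 1
  total′ = trans (sumℤ-↭ (↭-sym (↭P.∷↭∷ʳ y p))) total
  rotateʳ : HasRMLᴸ (p ++ [ y ]) (q ++ [ x ]) r → HasRMLᴸ (y ∷ p) (x ∷ q) (x + r)
  rotateʳ (k , rm , qk≡r) =
    suc k , to (isRightmostMin-rotate p y k<L total) rm , cong (_+_ x) prefix≡r
    where
    k≤L : k ≤ length p
    k≤L = ℕP.≤-pred (subst (k <_) (length-∷ʳ p y)
      (isRightmostMin-< _ (prefixℤ-beyond (p ++ [ y ]) total′) rm))
    prefix≡r : prefixℕ q k ≡ r
    prefix≡r = trans (sym (prefixℕ-++ˡ q [ x ] (subst (k ≤_) p≡q k≤L))) qk≡r
    k<L : k < length p
    k<L = ℕP.≤∧≢⇒< k≤L λ { refl →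
      ℕP.<⇒≢ r<sum (trans (sym prefix≡r) (prefixℕ-all q (ℕP.≤-reflexive (sym p≡q)))) }
  rotateˡ : HasRMLᴸ (y ∷ p) (x ∷ q) (x + r) → HasRMLᴸ (p ++ [ y ]) (q ++ [ x ]) r
  rotateˡ (zero , _ , 0≡x+r) = contradiction 0≡x+r (ℕP.<⇒≢ (ℕP.<-≤-trans 1≤x (ℕP.m≤m+n x r)))
  rotateˡ (suc k , rm , x+qk≡x+r) = k , from (isRightmostMin-rotate p y k<L total) rm ,
    trans (prefixℕ-++ˡ q [ x ] (subst (k ≤_) p≡q (ℕP.<⇒≤ k<L))) (ℕP.+-cancelˡ-≡ x _ _ x+qk≡x+r)
    where
    k<L : k < length p
    k<L = ℕP.≤-pred (isRightmostMin-< _ (prefixℤ-beyond (y ∷ p) total) rm)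

prefixℕ-shift : ∀ xa U xe xe′ {k} → k ≤ length U →
  prefixℕ (suc xa ∷ U ++ [ xe′ ]) (suc k) ≡ suc (prefixℕ (xa ∷ U ++ [ xe ]) (suc k))
prefixℕ-shift xa U xe xe′ k≤U = cong (λ t → suc (xa + t))
  (trans (prefixℕ-++ˡ U [ xe′ ] k≤U) (sym (prefixℕ-++ˡ U [ xe ] k≤U)))

hasRMLᴸ-shift : ∀ dys xa U xe xe′ {r} → length dys ≡ suc (suc (length U)) → sumℤ dys ≡ + 1 →
  1 ≤ r → HasRMLᴸ dys (xa ∷ U ++ [ xe ]) r ⇔ HasRMLᴸ dys (suc xa ∷ U ++ [ xe′ ]) (suc r)
hasRMLᴸ-shift dys xa U xe xe′ {r} len total 1≤r = mk⇔ shiftʳ shiftˡ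
  where
  interior : ∀ {k} → IsRightmostMin (prefixℤ dys) (suc k) → k ≤ length U
  interior rm = ℕP.≤-pred (ℕP.≤-pred (subst (_ <_) len
    (isRightmostMin-< _ (prefixℤ-beyond dys total) rm)))
  shiftʳ : HasRMLᴸ dys (xa ∷ U ++ [ xe ]) r → HasRMLᴸ dys (suc xa ∷ U ++ [ xe′ ]) (suc r)
  shiftʳ (zero  , _  , 0≡r) = contradiction (sym 0≡r) (ℕP.>⇒≢ 1≤r)
  shiftʳ (suc k , rm , b≡r) =
    suc k , rm , trans (prefixℕ-shift xa U xe xe′ (interior rm)) (cong suc b≡r)
  shiftˡ : HasRMLᴸ dys (suc xa ∷ U ++ [ xe′ ]) (suc r) → HasRMLᴸ dys (xa ∷ U ++ [ xe ]) r
  shiftˡ (zero  , _  , ())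
  shiftˡ (suc k , rm , b≡1+r) =
    suc k , rm , ℕP.suc-injective (trans (sym (prefixℕ-shift xa U xe xe′ (interior rm))) b≡1+r)

-- Lattice paths as lists of steps

Step : Set
Step = ℕ × ℤ

StepBounds : ℕ → ℕ → Step → Set
StepBounds n m s = (+ 1 ℤ.- + n ≤ℤ proj₂ s) × (proj₂ s ≤ℤ + 1) × (1 ≤ proj₁ s) × (proj₁ s ≤ m ∸ 1)

IsLatticeList : ℕ → ℕ → List Step → Set
IsLatticeList n m l = All (StepBounds n m) l × sumℤ (map proj₂ l) ≡ + 1 × sum (map proj₁ l) ≡ m

InMᴸ : ℕ → ℕ → ℕ → List Step → Set
InMᴸ n m r l = IsLatticeList n m l × HasRMLᴸ (map proj₂ l) (map proj₁ l) r

ends-positive : ∀ {n m} a U e → IsLatticeList n m (a ∷ U ++ [ e ]) → 1 ≤ proj₁ a × 1 ≤ proj₁ e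
ends-positive a U e (a-bounds All.∷ rest , _) =
  proj₁ (proj₂ (proj₂ a-bounds)) , proj₁ (proj₂ (proj₂ (All.head (AllP.++⁻ʳ U rest))))

isLatticeList-↭ : ∀ {n m l l′} → l ↭ l′ → IsLatticeList n m l → IsLatticeList n m l′
isLatticeList-↭ l↭l′ (bounds , ys-sum , xs-sum) =
  ↭P.All-resp-↭ l↭l′ bounds ,
  trans (sym (sumℤ-↭ (↭P.map⁺ proj₂ l↭l′))) ys-sum ,
  trans (sym (sum-↭ (↭P.map⁺ proj₁ l↭l′))) xs-sum

m+n≤o⇒m≤o∸1 : ∀ {m n o} → 1 ≤ n → m + n ≤ o → m ≤ o ∸ 1
m+n≤o⇒m≤o∸1 {m} {n} {o} 1≤n m+n≤o = ℕP.≤-trans (ℕP.m+n≤o⇒m≤o∸n m m+n≤o) (ℕP.∸-monoʳ-≤ o 1≤n)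

sum-ends : ∀ (a : Step) U e →
  sum (map proj₁ (a ∷ U ++ [ e ])) ≡ (proj₁ a + proj₁ e) + sum (map proj₁ U)
sum-ends (xa , _) U (xe , ye) = begin
  xa + sum (map proj₁ (U ++ [ (xe , ye) ])) ≡⟨ cong (λ t → xa + sum t) (LP.map-++ proj₁ U _) ⟩
  xa + sum (map proj₁ U ++ [ xe ])          ≡⟨ cong (_+_ xa) (sum-++ (map proj₁ U) _) ⟩
  xa + (sum (map proj₁ U) + (xe + 0))        ≡⟨ rearrange xa (sum (map proj₁ U)) xe ⟩
  (xa + xe) + sum (map proj₁ U)             ∎
  where
  open ≡-Reasoning
  rearrange : ∀ a s e → a + (s + (e + 0)) ≡ (a + e) + s
  rearrange = solve-∀

isLatticeList-rebalance : ∀ {n m xa ya U xe ye xa′ xe′} → 1 ≤ xa′ → 1 ≤ xe′ → xa + xe ≡ xa′ + xe′ →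
  IsLatticeList n m ((xa , ya) ∷ U ++ [ (xe , ye) ]) →
  IsLatticeList n m ((xa′ , ya) ∷ U ++ [ (xe′ , ye) ])
isLatticeList-rebalance {n} {m} {xa} {ya} {U} {xe} {ye} {xa′} {xe′} 1≤xa′ 1≤xe′ ends≡
  ((ya-lo , ya-hi , _) All.∷ rest , ys-sum , xs-sum) =
  firstBounds All.∷ AllP.++⁺ (AllP.++⁻ˡ U rest) (lastBounds All.∷ All.[]) ,
  trans (cong (λ t → ya +ℤ sumℤ t)
    (trans (LP.map-++ proj₂ U _) (sym (LP.map-++ proj₂ U _)))) ys-sum ,
  xs-sum′
  where
  xs-sum′ : sum (map proj₁ ((xa′ , ya) ∷ U ++ [ (xe′ , ye) ])) ≡ m
  xs-sum′ = begin
    sum (map proj₁ ((xa′ , ya) ∷ U ++ [ (xe′ , ye) ])) ≡⟨ sum-ends (xa′ , ya) U (xe′ , ye) ⟩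
    (xa′ + xe′) + sum (map proj₁ U)                  ≡⟨ cong (_+ sum (map proj₁ U)) ends≡ ⟨
    (xa + xe) + sum (map proj₁ U)                    ≡⟨ sum-ends (xa , ya) U (xe , ye) ⟨
    sum (map proj₁ ((xa , ya) ∷ U ++ [ (xe , ye) ]))   ≡⟨ xs-sum ⟩
    m                                                ∎
    where open ≡-Reasoning
  ends≤m : xa′ + xe′ ≤ m
  ends≤m = subst (xa′ + xe′ ≤_) (trans (sym (sum-ends (xa′ , ya) U (xe′ , ye))) xs-sum′)
    (ℕP.m≤m+n _ _)
  firstBounds : StepBounds n m (xa′ , ya)
  firstBounds = ya-lo , ya-hi , 1≤xa′ , m+n≤o⇒m≤o∸1 1≤xe′ ends≤m
  lastBounds : StepBounds n m (xe′ , ye)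
  lastBounds with ye-lo , ye-hi , _ ← All.head (AllP.++⁻ʳ U rest) =
    ye-lo , ye-hi , 1≤xe′ , m+n≤o⇒m≤o∸1 1≤xa′ (subst (_≤ m) (ℕP.+-comm xa′ xe′) ends≤m)

hasRMLᴸ-map-∷ʳ : ∀ l s {r} →
  HasRMLᴸ (map proj₂ (l ++ [ s ])) (map proj₁ (l ++ [ s ])) r
    ⇔ HasRMLᴸ (map proj₂ l ++ [ proj₂ s ]) (map proj₁ l ++ [ proj₁ s ]) r
hasRMLᴸ-map-∷ʳ l s {r} = mk⇔ (subst (λ A → A) maps≡) (subst (λ A → A) (sym maps≡))
  where
  maps≡ : HasRMLᴸ (map proj₂ (l ++ [ s ])) (map proj₁ (l ++ [ s ])) r
       ≡ HasRMLᴸ (map proj₂ l ++ [ proj₂ s ]) (map proj₁ l ++ [ proj₁ s ]) r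
  maps≡ = cong₂ (λ dys dxs → HasRMLᴸ dys dxs r) (LP.map-++ proj₂ l [ s ]) (LP.map-++ proj₁ l [ s ])

inMᴸ-rotate : ∀ {n m r} l x y → 1 ≤ x → x + r < m →
  InMᴸ n m r (l ++ [ (x , y) ]) ⇔ InMᴸ n m (x + r) ((x , y) ∷ l)
inMᴸ-rotate {n} {m} {r} l x y 1≤x x+r<m = mk⇔
  (λ (lat , rml) → let lat′ = isLatticeList-↭ {n} (↭-sym (↭P.∷↭∷ʳ (x , y) l)) lat
                   in lat′ , to (rml⇔ lat′) rml)
  (λ (lat′ , rml′) → isLatticeList-↭ {n} (↭P.∷↭∷ʳ (x , y) l) lat′ , from (rml⇔ lat′) rml′)
  where
  rml⇔ : IsLatticeList n m ((x , y) ∷ l) →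
    HasRMLᴸ (map proj₂ (l ++ [ (x , y) ])) (map proj₁ (l ++ [ (x , y) ])) r
      ⇔ HasRMLᴸ (y ∷ map proj₂ l) (x ∷ map proj₁ l) (x + r)
  rml⇔ (_ , ys-sum , xs-sum) = ⇔.trans (hasRMLᴸ-map-∷ʳ l (x , y))
    (hasRMLᴸ-rotate _ _ y x (trans (LP.length-map proj₂ l) (sym (LP.length-map proj₁ l)))
      ys-sum 1≤x (ℕP.+-cancelˡ-< x r _ (subst (x + r <_) (sym xs-sum) x+r<m)))

inMᴸ-shift : ∀ {n m r} xa ya U xe ye → 1 ≤ xa → 1 ≤ xe → 1 ≤ r →
  InMᴸ n m r ((xa , ya) ∷ U ++ [ (suc xe , ye) ])
    ⇔ InMᴸ n m (suc r) ((suc xa , ya) ∷ U ++ [ (xe , ye) ])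
inMᴸ-shift {n} {m} {r} xa ya U xe ye 1≤xa 1≤xe 1≤r = mk⇔
  (λ (lat , rml) →
    isLatticeList-rebalance {n} (s≤s z≤n) 1≤xe (ℕP.+-suc xa xe) lat , to (rml⇔ lat) rml)
  (λ (lat′ , rml′) →
    let lat = isLatticeList-rebalance {n} 1≤xa (s≤s z≤n) (sym (ℕP.+-suc xa xe)) lat′
    in lat , from (rml⇔ lat) rml′)
  where
  rml⇔ : IsLatticeList n m ((xa , ya) ∷ U ++ [ (suc xe , ye) ]) →
    HasRMLᴸ (ya ∷ map proj₂ (U ++ [ (suc xe , ye) ])) (xa ∷ map proj₁ (U ++ [ (suc xe , ye) ])) r
      ⇔ HasRMLᴸ (ya ∷ map proj₂ (U ++ [ (xe , ye) ])) (suc xa ∷ map proj₁ (U ++ [ (xe , ye) ]))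
                (suc r)
  rml⇔ (_ , ys-sum , _) = ⇔.trans (hasRMLᴸ-map-∷ʳ ((xa , ya) ∷ U) (suc xe , ye))
    (⇔.trans (hasRMLᴸ-shift _ xa _ (suc xe) xe length≡ ys-sum′ 1≤r)
      (⇔.sym (hasRMLᴸ-map-∷ʳ ((suc xa , ya) ∷ U) (xe , ye))))
    where
    length≡ : length (ya ∷ map proj₂ U ++ [ ye ]) ≡ suc (suc (length (map proj₁ U)))
    length≡ = cong suc (trans (length-∷ʳ (map proj₂ U) ye)
      (cong suc (trans (LP.length-map proj₂ U) (sym (LP.length-map proj₁ U)))))
    ys-sum′ : sumℤ (ya ∷ map proj₂ U ++ [ ye ]) ≡ + 1
    ys-sum′ = trans (cong (λ t → ya +ℤ sumℤ t) (sym (LP.map-++ proj₂ U _))) ys-sum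

InM : (n m r : ℕ) → Steps n → Set
InM n m r v = IsLatticePath n m v × HasRML v r

isLatticePath⇔isLatticeList : ∀ {n m} (v : Steps n) → IsLatticePath n m v ⇔ IsLatticeList n m (toList v)
isLatticePath⇔isLatticeList {n} {m} v = mk⇔
  (λ (bounds , sums) → VAllP.toList⁺ (VAllP.lookup⁻ {P = StepBounds n m} bounds) , sums)
  (λ (bounds , sums) → VAllP.lookup⁺ (VAllP.toList⁻ {P = StepBounds n m} bounds) , sums)

hasRML⇔hasRMLᴸ : ∀ {n r} (v : Steps n) → sumℤ (ys v) ≡ + 1 → HasRML v r ⇔ HasRMLᴸ (ys v) (xs v) r
hasRML⇔hasRMLᴸ {n} {r} v total = mk⇔
  (λ (i , min , rightmost , b≡r) → toℕ i , isRightmostMin-fromFin i above min rightmost , b≡r)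
  fromᴸ
  where
  above : ∀ j → suc (suc n) ≤ j → prefixℤ (ys v) 0 <ℤ prefixℤ (ys v) j
  above j n<j = prefixℤ-beyond (ys v) total j (ℕP.≤-trans
    (ℕP.≤-reflexive (trans (LP.length-map proj₂ (toList v)) (VP.length-toList v))) (ℕP.<⇒≤ n<j))
  fromᴸ : HasRMLᴸ (ys v) (xs v) r → HasRML v r
  fromᴸ (k , rm , b≡r) = i , proj₁ rm′ ∘ toℕ , isRightmostMin⇒rightmost i rm′ ,
                         trans (cong (prefixℕ (xs v)) i≡k) b≡r
    where
    k<N : k < suc (suc n)
    k<N = isRightmostMin-< _ above rm
    i : Fin (suc (suc n))
    i = fromℕ< k<N
    i≡k : toℕ i ≡ k
    i≡k = FP.toℕ-fromℕ< k<N
    rm′ : IsRightmostMin (prefixℤ (ys v)) (toℕ i)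
    rm′ = subst (IsRightmostMin (prefixℤ (ys v))) (sym i≡k) rm

inM⇔inMᴸ : ∀ {n m r} (v : Steps n) → InM n m r v ⇔ InMᴸ n m r (toList v)
inM⇔inMᴸ v = mk⇔
  (λ (lat , rml) → to (isLatticePath⇔isLatticeList v) lat ,
                   to (hasRML⇔hasRMLᴸ v (proj₁ (proj₂ lat))) rml)
  (λ (lat , rml) → from (isLatticePath⇔isLatticeList v) lat ,
                   from (hasRML⇔hasRMLᴸ v (proj₁ (proj₂ lat))) rml)

init-∷ʳ-last : ∀ {A : Set} {k} (w : Vec A (suc k)) → init w ∷ʳ last w ≡ w
init-∷ʳ-last w = sym (proj₂ (proj₂ (initLast w)))

toList-∷-∷ʳ : ∀ {k} a (u : Vec Step k) e → toList (a V.∷ (u ∷ʳ e)) ≡ a ∷ toList u ++ [ e ]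
toList-∷-∷ʳ a u e = cong (a ∷_) (VP.toList-∷ʳ e u)

inM⇔inMᴸ-initLast : ∀ {m r k} a (w : Vec Step (suc k)) →
  InM (suc k) m r (a V.∷ w) ⇔ InMᴸ (suc k) m r (a ∷ toList (init w) ++ [ last w ])
inM⇔inMᴸ-initLast {m} {r} {k} a w = ⇔.trans (inM⇔inMᴸ (a V.∷ w))
  (mk⇔ (subst (InMᴸ (suc k) m r) toList≡) (subst (InMᴸ (suc k) m r) (sym toList≡)))
  where
  toList≡ : toList (a V.∷ w) ≡ a ∷ toList (init w) ++ [ last w ]
  toList≡ = trans (cong (λ w′ → toList (a V.∷ w′)) (sym (init-∷ʳ-last w)))
                  (toList-∷-∷ʳ a (init w) (last w))

-- The bijection

-- The clauses for a step of x-length 0 are junk: such steps do not occur in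
-- lattice paths.
raise′ : ∀ {k} → Step → Vec Step k → Step → Vec Step (suc (suc k))
raise′ a         u (zero , ye)         = a V.∷ (u ∷ʳ (zero , ye))
raise′ a         u (suc zero , ye)     = (1 , ye) V.∷ a V.∷ u
raise′ (xa , ya) u (suc (suc xe) , ye) = (suc xa , ya) V.∷ (u ∷ʳ (suc xe , ye))

lower′ : ∀ {k} → Step → Vec Step k → Step → Vec Step (suc (suc k))
lower′ (zero , ya)         u e         = (zero , ya) V.∷ (u ∷ʳ e)
lower′ (suc zero , ya)     u e         = (u ∷ʳ e) ∷ʳ (1 , ya)
lower′ (suc (suc xa) , ya) u (xe , ye) = (suc xa , ya) V.∷ (u ∷ʳ (suc xe , ye))

raise : ∀ {k} → Vec Step (suc (suc k)) → Vec Step (suc (suc k))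
raise (a V.∷ w) = raise′ a (init w) (last w)

lower : ∀ {k} → Vec Step (suc (suc k)) → Vec Step (suc (suc k))
lower (a V.∷ w) = lower′ a (init w) (last w)

raise-∷ʳ : ∀ {k} a (u : Vec Step k) e → raise (a V.∷ (u ∷ʳ e)) ≡ raise′ a u e
raise-∷ʳ a u e = cong₂ (raise′ a) (VP.init-∷ʳ e u) (VP.last-∷ʳ e u)

lower-∷ʳ : ∀ {k} a (u : Vec Step k) e → lower (a V.∷ (u ∷ʳ e)) ≡ lower′ a u e
lower-∷ʳ a u e = cong₂ (lower′ a) (VP.init-∷ʳ e u) (VP.last-∷ʳ e u)

raise-rotate : ∀ {k} (w : Vec Step (suc k)) y → raise (w ∷ʳ (1 , y)) ≡ (1 , y) V.∷ w
raise-rotate (a V.∷ u) y = raise-∷ʳ a u (1 , y)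

lower-rotate : ∀ {k} (w : Vec Step (suc k)) y → lower ((1 , y) V.∷ w) ≡ w ∷ʳ (1 , y)
lower-rotate w y = cong (_∷ʳ (1 , y)) (init-∷ʳ-last w)

lower-raise′ : ∀ {k} a (u : Vec Step k) e → 1 ≤ proj₁ a → 1 ≤ proj₁ e →
  lower (raise′ a u e) ≡ a V.∷ (u ∷ʳ e)
lower-raise′ a             u (suc zero , ye)     _ _ = lower-rotate (a V.∷ u) ye
lower-raise′ (suc xa , ya) u (suc (suc xe) , ye) _ _ = lower-∷ʳ (suc (suc xa) , ya) u (suc xe , ye)

raise-lower′ : ∀ {k} a (u : Vec Step k) e → 1 ≤ proj₁ a → 1 ≤ proj₁ e →
  raise (lower′ a u e) ≡ a V.∷ (u ∷ʳ e)
raise-lower′ (suc zero , ya)     u e             _ _ = raise-rotate (u ∷ʳ e) ya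
raise-lower′ (suc (suc xa) , ya) u (suc xe , ye) _ _ = raise-∷ʳ (suc xa , ya) u (suc (suc xe) , ye)

raise′-inMᴸ : ∀ {n m r k} a (u : Vec Step k) e → 1 ≤ r → suc r < m →
  InMᴸ n m r (a ∷ toList u ++ [ e ]) → InMᴸ n m (suc r) (toList (raise′ a u e))
raise′-inMᴸ {n} a u (zero , ye) _ _ (lat , _) with () ← proj₂ (ends-positive {n} a (toList u) _ lat)
raise′-inMᴸ {n} a u (suc zero , ye) _ 1+r<m =
  to (inMᴸ-rotate {n} (a ∷ toList u) 1 ye (s≤s z≤n) 1+r<m)
raise′-inMᴸ {n} {m} {r} (xa , ya) u (suc (suc xe) , ye) 1≤r _ inM@(lat , _) =
  subst (InMᴸ n m (suc r)) (sym (toList-∷-∷ʳ _ u _))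
    (to (inMᴸ-shift {n} xa ya (toList u) (suc xe) ye 1≤xa (s≤s z≤n) 1≤r) inM)
  where
  1≤xa : 1 ≤ xa
  1≤xa = proj₁ (ends-positive {n} _ (toList u) _ lat)

lower′-inMᴸ : ∀ {n m r k} a (u : Vec Step k) e → 1 ≤ r → suc r < m →
  InMᴸ n m (suc r) (a ∷ toList u ++ [ e ]) → InMᴸ n m r (toList (lower′ a u e))
lower′-inMᴸ {n} (zero , ya) u e _ _ (lat , _) with () ← proj₁ (ends-positive {n} _ (toList u) e lat)
lower′-inMᴸ {n} {m} {r} (suc zero , ya) u e _ 1+r<m inM =
  subst (InMᴸ n m r) (sym toList≡)
    (from (inMᴸ-rotate {n} (toList u ++ [ e ]) 1 ya (s≤s z≤n) 1+r<m) inM)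
  where
  toList≡ : toList ((u ∷ʳ e) ∷ʳ (1 , ya)) ≡ (toList u ++ [ e ]) ++ [ (1 , ya) ]
  toList≡ = trans (VP.toList-∷ʳ _ (u ∷ʳ e)) (cong (_++ [ (1 , ya) ]) (VP.toList-∷ʳ e u))
lower′-inMᴸ {n} {m} {r} (suc (suc xa) , ya) u (xe , ye) 1≤r _ inM@(lat , _) =
  subst (InMᴸ n m r) (sym (toList-∷-∷ʳ _ u _))
    (from (inMᴸ-shift {n} (suc xa) ya (toList u) xe ye (s≤s z≤n) 1≤xe 1≤r) inM)
  where
  1≤xe : 1 ≤ xe
  1≤xe = proj₂ (ends-positive {n} _ (toList u) _ lat)

raise-inM : ∀ {k m r} (v : Steps (suc k)) → 1 ≤ r → suc r < m →
  InM (suc k) m r v → InM (suc k) m (suc r) (raise v)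
raise-inM {k} (a V.∷ w) 1≤r 1+r<m =
  from (inM⇔inMᴸ (raise (a V.∷ w)))
  ∘ raise′-inMᴸ {suc k} a (init w) (last w) 1≤r 1+r<m
  ∘ to (inM⇔inMᴸ-initLast a w)

lower-inM : ∀ {k m r} (v : Steps (suc k)) → 1 ≤ r → suc r < m →
  InM (suc k) m (suc r) v → InM (suc k) m r (lower v)
lower-inM {k} (a V.∷ w) 1≤r 1+r<m =
  from (inM⇔inMᴸ (lower (a V.∷ w)))
  ∘ lower′-inMᴸ {suc k} a (init w) (last w) 1≤r 1+r<m
  ∘ to (inM⇔inMᴸ-initLast a w)

lower-raise : ∀ {k m r} (v : Steps (suc k)) → InM (suc k) m r v → lower (raise v) ≡ v
lower-raise {k} (a V.∷ w) inM
  with 1≤a , 1≤e ← ends-positive {suc k} a _ _ (proj₁ (to (inM⇔inMᴸ-initLast a w) inM)) =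
  trans (lower-raise′ a (init w) (last w) 1≤a 1≤e) (cong (a V.∷_) (init-∷ʳ-last w))

raise-lower : ∀ {k m r} (v : Steps (suc k)) → InM (suc k) m r v → raise (lower v) ≡ v
raise-lower {k} (a V.∷ w) inM
  with 1≤a , 1≤e ← ends-positive {suc k} a _ _ (proj₁ (to (inM⇔inMᴸ-initLast a w) inM)) =
  trans (raise-lower′ a (init w) (last w) 1≤a 1≤e) (cong (a V.∷_) (init-∷ʳ-last w))

r≤m∸2⇒1+r<m : ∀ {r m} → 1 ≤ r → r ≤ m ∸ 2 → suc r < m
r≤m∸2⇒1+r<m {m = zero}        1≤r r≤0 = contradiction r≤0 (ℕP.<⇒≱ 1≤r)
r≤m∸2⇒1+r<m {m = suc zero}    1≤r r≤0 = contradiction r≤0 (ℕP.<⇒≱ 1≤r)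
r≤m∸2⇒1+r<m {m = suc (suc m)} _   r≤m = s≤s (s≤s r≤m)

lemma2p9 : (n m r : ℕ) → 1 ≤ n → suc n ≤ m → 1 ≤ r → r ≤ m ∸ 2 →
    Bijection (MSetoid n m r) (MSetoid n m (r + 1))
lemma2p9 zero    _ _ () _ _ _
lemma2p9 (suc n) m r _  _ 1≤r r≤m∸2 = Inverse⇒Bijection record
  { to        = λ (v , v∈M) → raise v , subst (λ r′ → InM (suc n) m r′ (raise v)) (ℕP.+-comm 1 r)
                                          (raise-inM v 1≤r 1+r<m v∈M)
  ; from      = λ (v , v∈M) → lower v , lower-inM v 1≤r 1+r<m
                                          (subst (λ r′ → InM (suc n) m r′ v) (ℕP.+-comm r 1) v∈M)
  ; to-cong   = cong raise
  ; from-cong = cong lower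
  ; inverse   = (λ {x} y≡lower-x → trans (cong raise y≡lower-x) (raise-lower (proj₁ x) (proj₂ x)))
              , (λ {x} y≡raise-x → trans (cong lower y≡raise-x) (lower-raise (proj₁ x) (proj₂ x)))
  }
  where
  1+r<m : suc r < m
  1+r<m = r≤m∸2⇒1+r<m 1≤r r≤m∸2
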